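{- Let $G$ be a finite simple undirected quasi-line graph. Then for every vertex $x \in V(G)$, $b(G-\{x\}) \geq b(G) - 2$.
   Context: A graph is quasi-line if the neighborhood of each vertex is covered by at most two cliques. A proper coloring of the vertices of a graph is a b-coloring if every color class contains a vertex adjacent to at least one vertex of every other color class. The b-chromatic number $b(G)$ is the largest integer $k$ such that $G$ admits a b-coloring with $k$ colors. $G-\{x\}$ denotes the graph obtained from $G$ by deleting $x$ and all edges incident to $x$. -}

module Defs where

open import Data.Nat using (ℕ; suc; _≤_)
open import Data.Fin using (Fin; punchIn)
open import Data.Product using (Σ; ∃; _×_; _,_)
open import Data.Sum using (_⊎_)
open import Relation.Nullary using (¬_; Dec)
open import Relation.Binary.PropositionalEquality using (_≡_; _≢_)

record Graph (n : ℕ) : Set₁ where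
  field
    Adj   : Fin n → Fin n → Set
    adj?  : (u v : Fin n) → Dec (Adj u v)
    sym   : ∀ {u v} → Adj u v → Adj v u
    irrefl : ∀ {u} → ¬ Adj u u
open Graph public

IsClique : ∀ {n} → Graph n → (Fin n → Set) → Set
IsClique G C = ∀ u w → C u → C w → u ≢ w → Adj G u w

QuasiLine : ∀ {n} → Graph n → Set₁
QuasiLine {n} G = ∀ (v : Fin n) →
  Σ (Fin n → Set) λ C₁ → Σ (Fin n → Set) λ C₂ →
    IsClique G C₁ × IsClique G C₂ ×
    (∀ u → Adj G v u → C₁ u ⊎ C₂ u)

_─_ : ∀ {n} → Graph (suc n) → Fin (suc n) → Graph n
G ─ x = record
  { Adj = λ u v → Adj G (punchIn x u) (punchIn x v)
  ; adj? = λ u v → adj? G (punchIn x u) (punchIn x v)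
  ; sym = sym G
  ; irrefl = irrefl G
  }

IsProper : ∀ {n k} → Graph n → (Fin n → Fin k) → Set
IsProper G c = ∀ u v → Adj G u v → c u ≢ c v

IsBColoring : ∀ {n k} → Graph n → (Fin n → Fin k) → Set
IsBColoring {n} {k} G c =
  IsProper G c ×
  (∀ (i : Fin k) → ∃ λ (v : Fin n) → c v ≡ i ×
     (∀ (j : Fin k) → j ≢ i → ∃ λ (u : Fin n) → Adj G v u × c u ≡ j))

HasBColoring : ∀ {n} → Graph n → ℕ → Set
HasBColoring {n} G k = Σ (Fin n → Fin k) λ c → IsBColoring G c

IsBChromaticNumber : ∀ {n} → Graph n → ℕ → Set
IsBChromaticNumber G b = HasBColoring G b × (∀ k → HasBColoring G k → k ≤ b)

module Submission where

-- Let c be a b-colouring of G with b colours, α = c x, and let N be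
-- the neighbourhood of x, viewed inside H = G − x.  Restricted to H, c is an
-- "almost b-colouring relative to α": every class s ≠ α has a witness that sees
-- all colours except s and α, and that sees α too unless it lies in N.
--
-- The basic move is to dissolve a colour class with no b-vertex, giving one
-- colour less (Elimination).  There are three cases.
--   * Dissolving α itself yields a b-colouring.
--   * Dissolving a bad class t ≠ α forces its witness v (which lies in N and
--     misses α) to take colour α.  v is then an anchor: a b-vertex of colour α
--     inside N.
--   * A second bad class t′ (now t′ ≠ α, since α has an anchor) provides a second
--     anchor v′, not adjacent to v.  Because N is covered by two cliques (the
--     quasi-line hypothesis), every witness inside N is adjacent to v or v′.
--     The result is a b-colouring.
-- At most two classes are lost, so b(G − x) ≥ b − 2.

open import Defs hiding (sym)
open import Data.Nat using (ℕ; suc; zero; _≤_; _∸_)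
open import Data.Nat.Properties using (≤-trans; ≤-refl; n≤1+n; m∸n≤m)
open import Data.Fin using (Fin; punchIn; punchOut; _≟_)
open import Data.Fin.Properties
  using (punchIn-injective; punchInᵢ≢i; punchIn-punchOut; any?; all?; ¬∀⟶∃¬)
open import Data.Product using (Σ; ∃; _×_; _,_; proj₁; proj₂)
open import Data.Sum using (_⊎_; inj₁; inj₂; map₁)
open import Data.Empty using (⊥-elim)
open import Function using (_∘_)
open import Relation.Nullary using (¬_; Dec; yes; no)
open import Relation.Nullary.Decidable using (_×-dec_; _→-dec_; ¬?)
open import Relation.Binary.PropositionalEquality

punchIn-≢ : ∀ {k} (t : Fin (suc k)) {i j : Fin k} → i ≢ j → punchIn t i ≢ punchIn t j
punchIn-≢ t i≢j = i≢j ∘ punchIn-injective t _ _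

module _ {m : ℕ} (H : Graph m) where

  Sees : ∀ {k} → (Fin m → Fin k) → Fin m → Fin k → Set
  Sees d v j = ∃ λ u → Adj H v u × d u ≡ j

  SeesAllBut : ∀ {k} → (Fin m → Fin k) → Fin m → Fin k → Set
  SeesAllBut d v i = ∀ j → j ≢ i → Sees d v j

  -- The class of colour i contains a b-vertex.  IsBColoring H d unfolds to
  -- IsProper H d × (∀ i → HasBVertex d i).
  HasBVertex : ∀ {k} → (Fin m → Fin k) → Fin k → Set
  HasBVertex d i = ∃ λ v → d v ≡ i × SeesAllBut d v i

  BColourableAtLeast : ℕ → Set
  BColourableAtLeast r = ∃ λ k → HasBColoring H k × r ≤ k

  sees? : ∀ {k} (d : Fin m → Fin k) v j → Dec (Sees d v j)
  sees? d v j = any? λ u → adj? H v u ×-dec (d u ≟ j)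

  seesAllBut? : ∀ {k} (d : Fin m → Fin k) v i → Dec (SeesAllBut d v i)
  seesAllBut? d v i = all? λ j → ¬? (j ≟ i) →-dec sees? d v j

  hasBVertex? : ∀ {k} (d : Fin m → Fin k) i → Dec (HasBVertex d i)
  hasBVertex? d i = any? λ v → (d v ≟ i) ×-dec seesAllBut? d v i

  bColouringOrBadClass : ∀ {k} (d : Fin m → Fin k) → IsProper H d →
                         IsBColoring H d ⊎ ∃ λ t → ¬ HasBVertex d t
  bColouringOrBadClass d proper with all? (hasBVertex? d)
  ... | yes allGood = inj₁ (proper , allGood)
  ... | no notAllGood = inj₂ (¬∀⟶∃¬ _ _ (hasBVertex? d) notAllGood)

  missedColour : ∀ {k} (d : Fin m → Fin k) v i → ¬ SeesAllBut d v i →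
                 ∃ λ j → j ≢ i × ¬ Sees d v j
  missedColour d v i notAll with ¬∀⟶∃¬ _ _ (λ j → ¬? (j ≟ i) →-dec sees? d v j) notAll
  ... | j , fails = j , (λ j≡i → fails λ j≢i → ⊥-elim (j≢i j≡i)) , (λ seen → fails λ _ → seen)

  record Elimination {k} (d : Fin m → Fin (suc k)) (i : Fin (suc k)) : Set where
    field
      colouring : Fin m → Fin k
      proper    : IsProper H colouring
      keeps     : ∀ u s → d u ≡ punchIn i s → colouring u ≡ s
      fresh     : ∀ u → d u ≡ i → ¬ Sees d u (punchIn i (colouring u))

    seesAfter : ∀ {v s} → Sees d v (punchIn i s) → Sees colouring v s
    seesAfter {s = s} (u , adj , du) = u , adj , keeps u s du

  -- A class with no b-vertex can always be dissolved: each of its vertices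
  -- misses some colour and moves there.
  eliminate : ∀ {k} (d : Fin m → Fin (suc k)) → IsProper H d →
              (i : Fin (suc k)) → ¬ HasBVertex d i → Elimination d i
  eliminate {k} d dProper i noBVertex = record
    { colouring = d′ ; proper = proper ; keeps = keeps ; fresh = fresh }
    where
      Spec : Fin m → Fin k → Set
      Spec u s = (d u ≢ i → punchIn i s ≡ d u) × (d u ≡ i → ¬ Sees d u (punchIn i s))

      choose : ∀ u → Dec (d u ≡ i) → Σ (Fin k) (Spec u)
      choose u (no du≢i) =
        punchOut (du≢i ∘ sym) , (λ _ → punchIn-punchOut _) , (λ du≡i → ⊥-elim (du≢i du≡i))
      choose u (yes du≡i) with missedColour d u i (λ seesAll → noBVertex (u , du≡i , seesAll))
      ... | j , j≢i , unseen =
        punchOut (j≢i ∘ sym) , (λ du≢i → ⊥-elim (du≢i du≡i)) ,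
        (λ _ → subst (¬_ ∘ Sees d u) (sym (punchIn-punchOut _)) unseen)

      d′ : Fin m → Fin k
      d′ u = proj₁ (choose u (d u ≟ i))

      renumbered : ∀ u → d u ≢ i → punchIn i (d′ u) ≡ d u
      renumbered u = proj₁ (proj₂ (choose u (d u ≟ i)))

      fresh : ∀ u → d u ≡ i → ¬ Sees d u (punchIn i (d′ u))
      fresh u = proj₂ (proj₂ (choose u (d u ≟ i)))

      clash : ∀ u w → Adj H u w → d u ≡ i → d w ≢ i → d′ u ≢ d′ w
      clash u w adj du≡i dw≢i eq =
        fresh u du≡i (w , adj , trans (sym (renumbered w dw≢i)) (cong (punchIn i) (sym eq)))

      properCases : ∀ u w → Adj H u w → Dec (d u ≡ i) → Dec (d w ≡ i) → d′ u ≢ d′ w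
      properCases u w adj (yes du≡i) (yes dw≡i) _ = dProper u w adj (trans du≡i (sym dw≡i))
      properCases u w adj (yes du≡i) (no dw≢i) = clash u w adj du≡i dw≢i
      properCases u w adj (no du≢i) (yes dw≡i) = clash w u (Graph.sym H adj) dw≡i du≢i ∘ sym
      properCases u w adj (no du≢i) (no dw≢i) eq =
        dProper u w adj (trans (sym (renumbered u du≢i))
                               (trans (cong (punchIn i) eq) (renumbered w dw≢i)))

      proper : IsProper H d′
      proper u w adj = properCases u w adj (d u ≟ i) (d w ≟ i)

      keeps : ∀ u s → d u ≡ punchIn i s → d′ u ≡ s
      keeps u s du = punchIn-injective i _ _ (trans (renumbered u du≢i) du)
        where
          du≢i : d u ≢ i
          du≢i = punchInᵢ≢i i s ∘ trans (sym du)

  CoveredByTwoCliques : (Fin m → Set) → Set₁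
  CoveredByTwoCliques N = Σ (Fin m → Set) λ C₁ → Σ (Fin m → Set) λ C₂ →
    IsClique H C₁ × IsClique H C₂ × (∀ u → N u → C₁ u ⊎ C₂ u)

  -- Two distinct non-adjacent vertices of N lie in different cliques, so any
  -- third vertex of N shares a clique with one of them.
  adjacentToOneOf : ∀ {N} → CoveredByTwoCliques N → ∀ {w p q} → N w → N p → N q →
                    ¬ Adj H p q → p ≢ q → w ≢ p → w ≢ q → Adj H w p ⊎ Adj H w q
  adjacentToOneOf (C₁ , C₂ , K₁ , K₂ , cover) {w} {p} {q} Nw Np Nq p≁q p≢q w≢p w≢q
    with cover w Nw | cover p Np | cover q Nq
  ... | _       | inj₁ C₁p | inj₁ C₁q = ⊥-elim (p≁q (K₁ p q C₁p C₁q p≢q))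
  ... | _       | inj₂ C₂p | inj₂ C₂q = ⊥-elim (p≁q (K₂ p q C₂p C₂q p≢q))
  ... | inj₁ C₁w | inj₁ C₁p | inj₂ _  = inj₁ (K₁ w p C₁w C₁p w≢p)
  ... | inj₁ C₁w | inj₂ _  | inj₁ C₁q = inj₂ (K₁ w q C₁w C₁q w≢q)
  ... | inj₂ C₂w | inj₁ _  | inj₂ C₂q = inj₂ (K₂ w q C₂w C₂q w≢q)
  ... | inj₂ C₂w | inj₂ C₂p | inj₁ _  = inj₁ (K₂ w p C₂w C₂p w≢p)

punchIn-onto : ∀ {n} (x w : Fin (suc n)) → w ≢ x → ∃ λ w′ → punchIn x w′ ≡ w
punchIn-onto x w w≢x = punchOut (w≢x ∘ sym) , punchIn-punchOut _

Neighbourhood : ∀ {n} (G : Graph (suc n)) (x : Fin (suc n)) → Fin n → Set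
Neighbourhood G x u = Adj G x (punchIn x u)

neighbourhoodCovered : ∀ {n} (G : Graph (suc n)) → QuasiLine G → (x : Fin (suc n)) →
                       CoveredByTwoCliques (G ─ x) (Neighbourhood G x)
neighbourhoodCovered G ql x with ql x
... | C₁ , C₂ , K₁ , K₂ , cover =
  C₁ ∘ punchIn x , C₂ ∘ punchIn x , restrict K₁ , restrict K₂ , cover ∘ punchIn x
  where
    restrict : ∀ {C} → IsClique G C → IsClique (G ─ x) (C ∘ punchIn x)
    restrict K u w Cu Cw u≢w = K _ _ Cu Cw (u≢w ∘ punchIn-injective x u w)

module _ {m : ℕ} (H : Graph m) (N : Fin m → Set) where

  Witness : ∀ {k} → (Fin m → Fin k) → Fin k → Fin k → Fin m → Set
  Witness d α s w =
    d w ≡ s × (∀ j → j ≢ s → j ≢ α → Sees H d w j) × (Sees H d w α ⊎ N w)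

  AlmostB : ∀ {k} → (Fin m → Fin k) → Fin k → Set
  AlmostB d α = ∀ s → s ≢ α → ∃ (Witness d α s)

  Anchor : ∀ {k} → (Fin m → Fin k) → Fin k → Fin m → Set
  Anchor d α v = d v ≡ α × N v × SeesAllBut H d v α

  module _ {k} {d : Fin m → Fin (suc k)} where

    -- Dissolving α itself leaves a b-colouring: every witness now sees all colours.
    eliminatingα : ∀ {α} → AlmostB d α → (E : Elimination H d α) →
                   IsBColoring H (Elimination.colouring E)
    eliminatingα {α} almost E = proper , bVertex
      where
        open Elimination E
        bVertex : ∀ s → HasBVertex H colouring s
        bVertex s with almost (punchIn α s) (punchInᵢ≢i α s)
        ... | w , dw , seesOthers , _ =
          w , keeps w s dw ,
          λ j j≢s → seesAfter (seesOthers _ (punchIn-≢ α j≢s) (punchInᵢ≢i α j))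

    almostPreserved : ∀ {α t α′} → AlmostB d α → t ≢ α → (E : Elimination H d t) →
                      punchIn t α′ ≡ α → AlmostB (Elimination.colouring E) α′
    almostPreserved {α} {t} {α′} almost t≢α E tα′≡α s s≢α′
      with almost (punchIn t s) (λ eq → punchIn-≢ t s≢α′ (trans eq (sym tα′≡α)))
    ... | w , dw , seesOthers , seesαOrN =
      w , keeps w s dw , seesOthers′ , map₁ seesα′ seesαOrN
      where
        open Elimination E
        notα : ∀ {j} → j ≢ α′ → punchIn t j ≢ α
        notα j≢α′ eq = punchIn-≢ t j≢α′ (trans eq (sym tα′≡α))
        seesOthers′ : ∀ j → j ≢ s → j ≢ α′ → Sees H colouring w j
        seesOthers′ j j≢s j≢α′ = seesAfter (seesOthers _ (punchIn-≢ t j≢s) (notα j≢α′))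
        seesα′ : Sees H d w α → Sees H colouring w α′
        seesα′ = seesAfter ∘ subst (Sees H d w) (sym tα′≡α)

    anchorPreserved : ∀ {α t α′ v} → Anchor d α v → (E : Elimination H d t) →
                      punchIn t α′ ≡ α → Anchor (Elimination.colouring E) α′ v
    anchorPreserved {α′ = α′} {v} (dv , Nv , seesAll) E tα′≡α =
      keeps v α′ (trans dv (sym tα′≡α)) , Nv ,
      λ j j≢α′ → seesAfter (seesAll _ (λ eq → punchIn-≢ _ j≢α′ (trans eq (sym tα′≡α))))
      where open Elimination E

    -- If class t ≠ α has no b-vertex, its witness v misses only α, so v lies in
    -- N, and dissolving t moves v to α, where v becomes an anchor.
    absorbed : ∀ {α t v} → t ≢ α → ¬ HasBVertex H d t → Witness d α t v →
               (E : Elimination H d t) → let open Elimination E in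
               ¬ Sees H d v α × punchIn t (colouring v) ≡ α ×
               Anchor colouring (colouring v) v
    absorbed {α} {t} {v} t≢α noBVertex (dv , seesOthers , seesαOrN) E =
      missesα , movesToα , refl , inN seesαOrN , seesAllNew
      where
        open Elimination E
        missesα : ¬ Sees H d v α
        missesα seesα = noBVertex (v , dv , seesAll)
          where
            seesAll : SeesAllBut H d v t
            seesAll j j≢t with j ≟ α
            ... | yes refl = seesα
            ... | no j≢α = seesOthers j j≢t j≢α
        inN : Sees H d v α ⊎ N v → N v
        inN (inj₁ seesα) = ⊥-elim (missesα seesα)
        inN (inj₂ Nv) = Nv
        movesToα : punchIn t (colouring v) ≡ α
        movesToα with punchIn t (colouring v) ≟ α
        ... | yes eq = eq
        ... | no ≢α = ⊥-elim (fresh v dv (seesOthers _ (punchInᵢ≢i t _) ≢α))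
        seesAllNew : SeesAllBut H colouring v (colouring v)
        seesAllNew j j≢new = seesAfter (seesOthers _ (punchInᵢ≢i t j)
          (λ eq → punchIn-≢ t j≢new (trans eq (sym movesToα))))

  -- Two distinct non-adjacent anchors of α complete an almost b-colouring:
  -- a witness in N is adjacent to one of them (N is covered by two cliques).
  completion : ∀ {k} {d : Fin m → Fin k} {α v₁ v₂} → CoveredByTwoCliques H N →
               AlmostB d α → Anchor d α v₁ → Anchor d α v₂ → ¬ Adj H v₁ v₂ → v₁ ≢ v₂ →
               ∀ s → HasBVertex H d s
  completion {d = d} {α} {v₁} {v₂} cover almost (dv₁ , Nv₁ , seesAll₁) (dv₂ , Nv₂ , _)
             v₁≁v₂ v₁≢v₂ s with s ≟ α
  ... | yes refl = v₁ , dv₁ , seesAll₁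
  ... | no s≢α with almost s s≢α
  ...   | w , dw , seesOthers , seesαOrN = w , dw , seesAll
    where
      notAnchor : ∀ {v} → d v ≡ α → w ≢ v
      notAnchor dv refl = s≢α (trans (sym dw) dv)
      seesα : Sees H d w α ⊎ N w → Sees H d w α
      seesα (inj₁ seen) = seen
      seesα (inj₂ Nw) with adjacentToOneOf H cover Nw Nv₁ Nv₂ v₁≁v₂ v₁≢v₂
                             (notAnchor dv₁) (notAnchor dv₂)
      ... | inj₁ adj = v₁ , adj , dv₁
      ... | inj₂ adj = v₂ , adj , dv₂
      seesAll : SeesAllBut H d w s
      seesAll j j≢s with j ≟ α
      ... | yes refl = seesα seesαOrN
      ... | no j≢α = seesOthers j j≢s j≢α

  fromAnchored : CoveredByTwoCliques H N → ∀ {k} (d : Fin m → Fin k) → IsProper H d →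
                 ∀ {α v₁} → AlmostB d α → Anchor d α v₁ → BColourableAtLeast H (k ∸ 1)
  fromAnchored cover {zero} d proper {()}
  fromAnchored cover {suc k} d proper {α} {v₁} almost anchor₁@(dv₁ , _ , seesAll₁)
    with bColouringOrBadClass H d proper
  ... | inj₁ isB = suc k , (d , isB) , n≤1+n k
  ... | inj₂ (t , noBVertex) with t ≟ α
  ...   | yes refl = ⊥-elim (noBVertex (v₁ , dv₁ , seesAll₁))
  ...   | no t≢α with almost t t≢α
  ...     | v₂ , witness₂@(dv₂ , _)
    with absorbed t≢α noBVertex witness₂ (eliminate H d proper t noBVertex)
  ...       | v₂missesα , tα′≡α , anchor₂ =
    k , (colouring , proper′ , allGood) , ≤-refl
    where
      E : Elimination H d t
      E = eliminate H d proper t noBVertex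
      open Elimination E renaming (proper to proper′)
      v₁≁v₂ : ¬ Adj H v₁ v₂
      v₁≁v₂ adj = v₂missesα (v₁ , Graph.sym H adj , dv₁)
      v₁≢v₂ : v₁ ≢ v₂
      v₁≢v₂ refl = t≢α (trans (sym dv₂) dv₁)
      allGood : ∀ s → HasBVertex H colouring s
      allGood = completion cover (almostPreserved almost t≢α E tα′≡α)
        (anchorPreserved anchor₁ E tα′≡α) anchor₂ v₁≁v₂ v₁≢v₂

  fromAlmost : CoveredByTwoCliques H N → ∀ {k} (d : Fin m → Fin k) → IsProper H d →
               ∀ {α} → AlmostB d α → BColourableAtLeast H (k ∸ 2)
  fromAlmost cover {zero} d proper {()}
  fromAlmost cover {suc k} d proper {α} almost with bColouringOrBadClass H d proper
  ... | inj₁ isB = suc k , (d , isB) , ≤-trans (m∸n≤m k 1) (n≤1+n k)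
  ... | inj₂ (t , noBVertex) with t ≟ α
  ...   | yes refl = k , (_ , eliminatingα almost (eliminate H d proper t noBVertex)) , m∸n≤m k 1
  ...   | no t≢α with almost t t≢α
  ...     | _ , witness
    with absorbed t≢α noBVertex witness (eliminate H d proper t noBVertex)
  ...       | _ , tα′≡α , anchor =
    fromAnchored cover colouring proper′ (almostPreserved almost t≢α E tα′≡α) anchor
    where
      E : Elimination H d t
      E = eliminate H d proper t noBVertex
      open Elimination E renaming (proper to proper′)

-- Restricting a b-colouring c of G to G − x gives an almost b-colouring relative
-- to c x: a b-vertex of another class can only lose its neighbour x.
restriction : ∀ {n k} (G : Graph (suc n)) (x : Fin (suc n)) (c : Fin (suc n) → Fin k) →
              IsBColoring G c →
              IsProper (G ─ x) (c ∘ punchIn x) ×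
              AlmostB (G ─ x) (Neighbourhood G x) (c ∘ punchIn x) (c x)
restriction G x c (cProper , bVertex) =
  (λ u v → cProper (punchIn x u) (punchIn x v)) , almost
  where
    H : Graph _
    H = G ─ x
    seenInH : ∀ {v u} → Adj G (punchIn x v) u → u ≢ x → Sees H (c ∘ punchIn x) v (c u)
    seenInH adj u≢x with punchIn-onto x _ u≢x
    ... | u′ , refl = u′ , adj , refl
    almost : AlmostB H (Neighbourhood G x) (c ∘ punchIn x) (c x)
    almost s s≢cx with bVertex s
    ... | w , cw , seesAll with punchIn-onto x w (λ { refl → s≢cx (sym cw) })
    ...   | w′ , refl = w′ , cw , seesOthers , seesOrN (seesAll (c x) (s≢cx ∘ sym))
      where
        seesOthers : ∀ j → j ≢ s → j ≢ c x → Sees H (c ∘ punchIn x) w′ j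
        seesOthers j j≢s j≢cx with seesAll j j≢s
        ... | u , adj , refl = seenInH adj (λ { refl → j≢cx refl })
        seesOrN : Sees G c (punchIn x w′) (c x) →
                  Sees H (c ∘ punchIn x) w′ (c x) ⊎ Neighbourhood G x w′
        seesOrN (u , adj , cu) with u ≟ x
        ... | yes refl = inj₂ (Graph.sym G adj)
        ... | no u≢x = inj₁ (subst (Sees H _ w′) cu (seenInH adj u≢x))

theorem4 : ∀ {n} (G : Graph (suc n)) → QuasiLine G → (x : Fin (suc n)) →
    ∀ (b b′ : ℕ) → IsBChromaticNumber G b → IsBChromaticNumber (G ─ x) b′ →
    b ∸ 2 ≤ b′
theorem4 G ql x b b′ ((c , cIsB) , _) (_ , maximal)
  with restriction G x c cIsB
... | proper , almost
  with fromAlmost (G ─ x) (Neighbourhood G x) (neighbourhoodCovered G ql x)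
                  (c ∘ punchIn x) proper almost
...   | k , bColouring , b∸2≤k = ≤-trans b∸2≤k (maximal k bColouring)
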